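{- Let $n\ge1$. Over the complementary alphabet $\{B,\overline{B}\}$ (one complementary pair), the number of words $P$ of length $2n$ having exactly one $P$-valid plane tree is $2n$; that is, $|N(n,1,1)|=2n$.
   Context: Here $B$ and $\overline{B}$ are complements of each other. A plane tree is a rooted tree with linearly ordered children at each vertex. For a plane tree with $n$ edges, the $2n$ half-edges are labeled $1,\dots,2n$ by starting on the left side of the leftmost root edge and walking counterclockwise; each edge is $e(i,j)$, $i<j$, with $i,j$ the labels of its sides. For $P=p_1\cdots p_{2n}$, a plane tree with $n$ edges is $P$-valid if $p_i,p_j$ are complements for every edge $e(i,j)$. $N(n,m,k)$ is the set of words $P$ of length $2n$ over a complementary alphabet with $m$ pairs having exactly $k\ge1$ $P$-valid plane trees. -}

module Defs where

open import Data.Nat using (ℕ; zero; suc; _+_; _*_)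
open import Data.List using (List; []; _∷_; _++_)
open import Data.Vec using (Vec; toList)
open import Data.Maybe using (Maybe; just; nothing)
open import Data.Product using (Σ; _×_; _,_)
open import Data.List.Membership.Propositional using (_∈_)
open import Relation.Binary.PropositionalEquality using (_≡_)

data Letter : Set where
  B  : Letter
  B̄ : Letter

complement : Letter → Letter
complement B  = B̄
complement B̄ = B

data PlaneTree : Set where
  node : List PlaneTree → PlaneTree

mutual
  size : PlaneTree → ℕ
  size (node ts) = sizeF ts

  sizeF : List PlaneTree → ℕ
  sizeF []       = 0
  sizeF (t ∷ ts) = suc (size t) + sizeF ts

mutual
  -- edgesFrom k T : the edges e(i,j) of T, where half-edge labels of T start at k
  -- and follow the counterclockwise contour walk starting on the left side of
  -- the leftmost root edge.  A root edge to child t, entered at label k, gets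
  -- i = k, the subtree of t uses labels k+1 .. k+2*size t, and j = k+1+2*size t.
  edgesFrom : ℕ → PlaneTree → List (ℕ × ℕ)
  edgesFrom k (node ts) = edgesF k ts

  edgesF : ℕ → List PlaneTree → List (ℕ × ℕ)
  edgesF k []       = []
  edgesF k (t ∷ ts) =
    (k , suc k + 2 * size t) ∷ (edgesFrom (suc k) t ++ edgesF (suc (suc k + 2 * size t)) ts)

edges : PlaneTree → List (ℕ × ℕ)
edges T = edgesFrom 1 T

-- letter at 1-based position i of a word
at : List Letter → ℕ → Maybe Letter
at []       _             = nothing
at (x ∷ xs) zero          = nothing
at (x ∷ xs) (suc zero)    = just x
at (x ∷ xs) (suc (suc i)) = at xs (suc i)

Complementary : List Letter → ℕ → ℕ → Set
Complementary P i j = Σ Letter λ a → at P i ≡ just a × at P j ≡ just (complement a)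

Valid : ∀ {n} → Vec Letter (2 * n) → PlaneTree → Set
Valid P T = ∀ {i j} → (i , j) ∈ edges T → Complementary (toList P) i j

ExactlyOneValid : (n : ℕ) → Vec Letter (2 * n) → Set
ExactlyOneValid n P =
  Σ PlaneTree λ T → size T ≡ n × Valid {n} P T ×
    (∀ T′ → size T′ ≡ n → Valid {n} P T′ → T′ ≡ T)

module Submission where

-- A tree is P-valid exactly when P is a contour word of its root forest in which the two sides of
-- every edge carry complementary letters; such words are generated by the grammar Labelled.  If a
-- word has only one labelled forest, so do the word of the first tree's children and the word of the
-- remaining trees, hence by induction both have the form x^a x̄^a x̄^c x^c.  Every way of combining
-- them except a^k ā^k under the first edge followed by ā^c a^c beside it admits a second forest,
-- obtained by splitting off or nesting edges; so the word itself has that form with a ≥ 1.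
-- Conversely, in x^a x̄^a x̄^c x^c the partner of the leading letter must close a balanced prefix,
-- which forces the forest.  With x ∈ {B, B̄} and 1 ≤ a ≤ n, a + c = n, there are 2n such words.

open import Defs
open import Data.Nat using (ℕ; zero; suc; pred; _+_; _*_; _∸_; _≥_; _<_; _≤_; s≤s)
open import Data.Nat.Properties
open import Data.Nat.Tactic.RingSolver using (solve-∀)
open import Data.Fin using (Fin; toℕ; fromℕ<)
open import Data.Fin.Properties using (toℕ-injective; toℕ<n; toℕ-fromℕ<)
open import Data.Vec as Vec using (Vec; toList; fromList; cast)
open import Data.Vec.Properties using (toList∘fromList; length-toList; toList-injective)
open import Data.Vec.Relation.Binary.Equality.Cast using (cast-is-id)
open import Data.List using (List; []; _∷_; _++_; length; replicate; map; allFin)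
open import Data.List.Properties
  using (++-assoc; length-++; ++-identityʳ; ++-identityʳ-unique; ∷-injectiveˡ; ∷-injectiveʳ;
         length-replicate; length-map; length-tabulate)
open import Data.List.Membership.Propositional using (_∈_)
open import Data.List.Membership.Propositional.Properties
  using (∈-++⁻; ∈-++⁺ˡ; ∈-++⁺ʳ; ∈-map⁻; ∈-map⁺; ∈-allFin)
open import Data.List.Relation.Unary.Any using (here; there)
open import Data.List.Relation.Unary.Unique.Propositional using (Unique)
open import Data.List.Relation.Unary.Unique.Propositional.Properties using (++⁺; map⁺; allFin⁺)
open import Data.Maybe using (just)
open import Data.Maybe.Properties using (just-injective)
open import Data.Product using (Σ; _×_; _,_)
open import Data.Sum using (_⊎_; inj₁; inj₂; [_,_]′)
open import Data.Empty using (⊥; ⊥-elim)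
open import Function using (_∘_; id)
open import Function.Bundles using (_⇔_; mk⇔)
open import Relation.Nullary using (¬_)
open import Relation.Binary.PropositionalEquality

complement-involutive : ∀ a → complement (complement a) ≡ a
complement-involutive B  = refl
complement-involutive B̄ = refl

complement-irreflexive : ∀ a → a ≢ complement a
complement-irreflexive B  ()
complement-irreflexive B̄ ()

≡-or-≡-complement : ∀ a b → b ≡ a ⊎ b ≡ complement a
≡-or-≡-complement B  B  = inj₁ refl
≡-or-≡-complement B  B̄ = inj₂ refl
≡-or-≡-complement B̄ B  = inj₂ refl
≡-or-≡-complement B̄ B̄ = inj₁ refl

node-injective : ∀ {ts ts′} → node ts ≡ node ts′ → ts ≡ ts′
node-injective refl = refl

data Labelled : List PlaneTree → List Letter → Set where
  empty  : Labelled [] []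
  branch : ∀ {cs ts u v} a → Labelled cs u → Labelled ts v →
           Labelled (node cs ∷ ts) (a ∷ u ++ complement a ∷ v)

branch′ : ∀ {cs ts u v} x y → complement x ≡ y → Labelled cs u → Labelled ts v →
          Labelled (node cs ∷ ts) (x ∷ u ++ y ∷ v)
branch′ x _ refl = branch x

Labelled-length : ∀ {F w} → Labelled F w → length w ≡ 2 * sizeF F
Labelled-length empty = refl
Labelled-length (branch {cs} {ts} {u} {v} a p q) = begin
  suc (length (u ++ complement a ∷ v))    ≡⟨ cong suc (length-++ u) ⟩
  suc (length u + suc (length v))
    ≡⟨ cong₂ (λ l l′ → suc (l + suc l′)) (Labelled-length p) (Labelled-length q) ⟩
  suc (2 * sizeF cs + suc (2 * sizeF ts)) ≡⟨ arith (sizeF cs) (sizeF ts) ⟩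
  2 * (suc (sizeF cs) + sizeF ts)         ∎
  where
  open ≡-Reasoning
  arith : ∀ s t → suc (2 * s + suc (2 * t)) ≡ 2 * (suc s + t)
  arith = solve-∀

Labelled-++ : ∀ {F G u v} → Labelled F u → Labelled G v → Labelled (F ++ G) (u ++ v)
Labelled-++ empty q = q
Labelled-++ {v = v} (branch {u = u₁} {v = v₁} a p₁ p₂) q =
  subst (Labelled _) (cong (a ∷_) (sym (++-assoc u₁ (complement a ∷ v₁) v)))
    (branch a p₁ (Labelled-++ p₂ q))

at-middle : ∀ pre (x : Letter) post → at (pre ++ x ∷ post) (suc (length pre)) ≡ just x
at-middle []        x post = refl
at-middle (_ ∷ pre) x post = at-middle pre x post

∷-splitAt : ∀ {A : Set} (xs : List A) m n → length xs ≡ m + suc n →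
  Σ (List A) λ u → Σ A λ b → Σ (List A) λ v → xs ≡ u ++ b ∷ v × length u ≡ m × length v ≡ n
∷-splitAt []       zero    n ()
∷-splitAt []       (suc m) n ()
∷-splitAt (b ∷ xs) zero    n e = [] , b , xs , refl , refl , suc-injective e
∷-splitAt (x ∷ xs) (suc m) n e with ∷-splitAt xs m n (suc-injective e)
... | u , b , v , refl , |u| , |v| = x ∷ u , b , v , refl , cong suc |u| , |v|

module Context (pre : List Letter) (a : Letter) (u : List Letter) (c : Letter) (v post : List Letter) where

  child-context : (pre ++ a ∷ []) ++ u ++ c ∷ v ++ post ≡ pre ++ (a ∷ u ++ c ∷ v) ++ post
  child-context =
    trans (++-assoc pre (a ∷ []) _) (cong (λ z → pre ++ a ∷ z) (sym (++-assoc u (c ∷ v) post)))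

  closing-context : (pre ++ a ∷ u) ++ c ∷ v ++ post ≡ pre ++ (a ∷ u ++ c ∷ v) ++ post
  closing-context =
    trans (++-assoc pre (a ∷ u) _) (cong (λ z → pre ++ a ∷ z) (sym (++-assoc u (c ∷ v) post)))

  sibling-context : (pre ++ a ∷ u ++ c ∷ []) ++ v ++ post ≡ pre ++ (a ∷ u ++ c ∷ v) ++ post
  sibling-context = trans (++-assoc pre (a ∷ u ++ c ∷ []) _)
    (cong (λ z → pre ++ a ∷ z) (trans (++-assoc u (c ∷ []) (v ++ post)) (sym (++-assoc u (c ∷ v) post))))

  child-position : suc (suc (length pre)) ≡ suc (length (pre ++ a ∷ []))
  child-position = cong suc (sym (trans (length-++ pre) (+-comm (length pre) 1)))

  module _ (s : ℕ) (|u| : length u ≡ 2 * s) where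

    closing-position : suc (suc (length pre)) + 2 * s ≡ suc (length (pre ++ a ∷ u))
    closing-position = begin
      suc (suc (length pre)) + 2 * s  ≡⟨ arith (length pre) s ⟩
      suc (length pre + suc (2 * s))  ≡⟨ cong (λ l → suc (length pre + suc l)) |u| ⟨
      suc (length pre + suc (length u)) ≡⟨ cong suc (length-++ pre) ⟨
      suc (length (pre ++ a ∷ u))     ∎
      where
      open ≡-Reasoning
      arith : ∀ p s → suc (suc p) + 2 * s ≡ suc (p + suc (2 * s))
      arith = solve-∀

    sibling-position : suc (suc (suc (length pre)) + 2 * s) ≡ suc (length (pre ++ a ∷ u ++ c ∷ []))
    sibling-position = begin
      suc (suc (suc (length pre)) + 2 * s)  ≡⟨ arith (length pre) s ⟩
      suc (length pre + suc (2 * s + 1))    ≡⟨ cong (λ l → suc (length pre + suc (l + 1))) |u| ⟨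
      suc (length pre + suc (length u + 1)) ≡⟨ cong (λ l → suc (length pre + suc l)) (length-++ u) ⟨
      suc (length pre + length (a ∷ u ++ c ∷ [])) ≡⟨ cong suc (length-++ pre) ⟨
      suc (length (pre ++ a ∷ u ++ c ∷ [])) ∎
      where
      open ≡-Reasoning
      arith : ∀ p s → suc (suc (suc p) + 2 * s) ≡ suc (p + suc (2 * s + 1))
      arith = solve-∀

EdgesComplementary : List Letter → ℕ → List PlaneTree → Set
EdgesComplementary w k F = ∀ {i j} → (i , j) ∈ edgesF k F → Complementary w i j

relocate : ∀ {w w′ k k′ F} → w ≡ w′ → k ≡ k′ →
  EdgesComplementary w k F → EdgesComplementary w′ k′ F
relocate refl refl h = h

labelled⇒complementary : ∀ {F seg} → Labelled F seg → ∀ pre post →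
  EdgesComplementary (pre ++ seg ++ post) (suc (length pre)) F
labelled⇒complementary empty pre post ()
labelled⇒complementary (branch {cs} {ts} {u} {v} a p q) pre post (here refl) =
  a , at-middle pre a _ ,
  subst₂ (λ w i → at w i ≡ just (complement a))
    closing-context (sym (closing-position (sizeF cs) (Labelled-length p)))
    (at-middle (pre ++ a ∷ u) (complement a) (v ++ post))
  where open Context pre a u (complement a) v post
labelled⇒complementary (branch {cs} {ts} {u} {v} a p q) pre post (there e)
  with ∈-++⁻ (edgesF (suc (suc (length pre))) cs) e
... | inj₁ e′ = relocate child-context (sym child-position)
                  (labelled⇒complementary p (pre ++ a ∷ []) (complement a ∷ v ++ post)) e′
  where open Context pre a u (complement a) v post
... | inj₂ e′ = relocate sibling-context (sym (sibling-position (sizeF cs) (Labelled-length p)))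
                  (labelled⇒complementary q (pre ++ a ∷ u ++ complement a ∷ []) post) e′
  where open Context pre a u (complement a) v post

complementary⇒labelled : ∀ F pre seg post → length seg ≡ 2 * sizeF F →
  EdgesComplementary (pre ++ seg ++ post) (suc (length pre)) F → Labelled F seg
complementary⇒labelled [] pre [] post _ _ = empty
complementary⇒labelled (node cs ∷ ts) pre (a ∷ rest) post |seg| h
  with ∷-splitAt rest (2 * sizeF cs) (2 * sizeF ts) (suc-injective (trans |seg| (arith (sizeF cs) (sizeF ts))))
  where
  arith : ∀ s t → 2 * (suc s + t) ≡ suc (2 * s + suc (2 * t))
  arith = solve-∀
... | u , b , v , refl , |u| , |v| with h (here refl)
... | a′ , opening , closing with just-injective (trans (sym opening) (at-middle pre a _))
... | refl with just-injective (trans (sym closing)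
                  (subst₂ (λ w i → at w i ≡ just b) closing-context (sym (closing-position (sizeF cs) |u|))
                    (at-middle (pre ++ a ∷ u) b (v ++ post))))
  where open Context pre a u b v post
... | refl = branch a
  (complementary⇒labelled cs (pre ++ a ∷ []) u _ |u|
    (relocate (sym child-context) child-position (h ∘ there ∘ ∈-++⁺ˡ)))
  (complementary⇒labelled ts (pre ++ a ∷ u ++ complement a ∷ []) v post |v|
    (relocate (sym sibling-context) (sibling-position (sizeF cs) |u|) (h ∘ there ∘ ∈-++⁺ʳ _)))
  where open Context pre a u (complement a) v post

Labelled-size : ∀ n {F} (P : Vec Letter (2 * n)) → Labelled F (toList P) → sizeF F ≡ n
Labelled-size n {F} P p = *-cancelˡ-≡ (sizeF F) n 2 (trans (sym (Labelled-length p)) (length-toList P))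

labelled⇒valid : ∀ n {F} (P : Vec Letter (2 * n)) → Labelled F (toList P) → Valid {n} P (node F)
labelled⇒valid n P p = relocate (++-identityʳ (toList P)) refl (labelled⇒complementary p [] [])

valid⇒labelled : ∀ n (P : Vec Letter (2 * n)) F → sizeF F ≡ n →
  Valid {n} P (node F) → Labelled F (toList P)
valid⇒labelled _ P F refl valid =
  complementary⇒labelled F [] (toList P) [] (length-toList P)
    (relocate (sym (++-identityʳ (toList P))) refl valid)

OnlyForest : List PlaneTree → List Letter → Set
OnlyForest F w = ∀ F′ → Labelled F′ w → F′ ≡ F

onlyForest-≡ : ∀ {F F₁ F₂ w} → OnlyForest F w → Labelled F₁ w → Labelled F₂ w → F₁ ≡ F₂
onlyForest-≡ only p q = trans (only _ p) (sym (only _ q))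

exactlyOneValid⇒onlyForest : ∀ n (P : Vec Letter (2 * n)) → ExactlyOneValid n P →
  Σ (List PlaneTree) λ F → Labelled F (toList P) × OnlyForest F (toList P)
exactlyOneValid⇒onlyForest n P (node F , |F| , valid , unique) =
  F , valid⇒labelled n P F |F| valid ,
  λ F′ p → node-injective (unique (node F′) (Labelled-size n P p) (labelled⇒valid n P p))

onlyForest⇒exactlyOneValid : ∀ n (P : Vec Letter (2 * n)) {F} →
  Labelled F (toList P) → OnlyForest F (toList P) → ExactlyOneValid n P
onlyForest⇒exactlyOneValid n P {F} p only =
  node F , Labelled-size n P p , labelled⇒valid n P p ,
  λ { (node F′) |F′| valid → cong node (only F′ (valid⇒labelled n P F′ |F′| valid)) }

replicate-+ : ∀ {A : Set} m n (z : A) → replicate (m + n) z ≡ replicate m z ++ replicate n z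
replicate-+ zero    n z = refl
replicate-+ (suc m) n z = cong (z ∷_) (replicate-+ m n z)

replicate-++-∷ : ∀ {A : Set} n (z : A) r → replicate n z ++ z ∷ r ≡ z ∷ replicate n z ++ r
replicate-++-∷ zero    z r = refl
replicate-++-∷ (suc n) z r = cong (z ∷_) (replicate-++-∷ n z r)

replicate-++-replicate : ∀ {A : Set} m n (z : A) r →
  replicate m z ++ replicate n z ++ r ≡ replicate (m + n) z ++ r
replicate-++-replicate m n z r =
  trans (sym (++-assoc (replicate m z) (replicate n z) r)) (cong (_++ r) (sym (replicate-+ m n z)))

path : ℕ → List PlaneTree
path zero    = []
path (suc k) = node (path k) ∷ []

path-labelled : ∀ x y → complement x ≡ y → ∀ k → Labelled (path k) (replicate k x ++ replicate k y)
path-labelled x y x̄≡y zero    = empty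
path-labelled x y x̄≡y (suc k) =
  subst (Labelled _) (cong (x ∷_) regroup) (branch′ x y x̄≡y (path-labelled x y x̄≡y k) empty)
  where
  regroup : (replicate k x ++ replicate k y) ++ y ∷ [] ≡ replicate k x ++ y ∷ replicate k y
  regroup = trans (++-assoc (replicate k x) (replicate k y) (y ∷ []))
    (cong (replicate k x ++_) (trans (replicate-++-∷ k y []) (cong (y ∷_) (++-identityʳ _))))

canonical : Letter → Letter → ℕ → ℕ → List Letter
canonical x y a c = replicate a x ++ replicate a y ++ replicate c y ++ replicate c x

canonical-labelled : ∀ x y → complement x ≡ y → complement y ≡ x → ∀ a c →
  Labelled (path a ++ path c) (canonical x y a c)
canonical-labelled x y x̄≡y ȳ≡x a c = subst (Labelled _) (++-assoc (replicate a x) (replicate a y) _)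
  (Labelled-++ (path-labelled x y x̄≡y a) (path-labelled y x ȳ≡x c))

δ : Letter → Letter → ℕ
δ B  B  = 1
δ B̄ B̄ = 1
δ B  B̄ = 0
δ B̄ B  = 0

occurrences : Letter → List Letter → ℕ
occurrences z []      = 0
occurrences z (l ∷ w) = δ z l + occurrences z w

occurrences-++ : ∀ z u v → occurrences z (u ++ v) ≡ occurrences z u + occurrences z v
occurrences-++ z []      v = refl
occurrences-++ z (l ∷ u) v = trans (cong (δ z l +_) (occurrences-++ z u v)) (sym (+-assoc (δ z l) _ _))

occurrences-replicate-≡ : ∀ z k → occurrences z (replicate k z) ≡ k
occurrences-replicate-≡ B  zero    = refl
occurrences-replicate-≡ B  (suc k) = cong suc (occurrences-replicate-≡ B k)
occurrences-replicate-≡ B̄ zero    = refl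
occurrences-replicate-≡ B̄ (suc k) = cong suc (occurrences-replicate-≡ B̄ k)

occurrences-replicate-≢ : ∀ {z y} → z ≢ y → ∀ k → occurrences z (replicate k y) ≡ 0
occurrences-replicate-≢ z≢y zero = refl
occurrences-replicate-≢ {B}  {B}  z≢y (suc k) = ⊥-elim (z≢y refl)
occurrences-replicate-≢ {B}  {B̄} z≢y (suc k) = occurrences-replicate-≢ z≢y k
occurrences-replicate-≢ {B̄} {B}  z≢y (suc k) = occurrences-replicate-≢ z≢y k
occurrences-replicate-≢ {B̄} {B̄} z≢y (suc k) = ⊥-elim (z≢y refl)

Balanced : List Letter → Set
Balanced w = ∀ z → occurrences z w ≡ occurrences (complement z) w

Labelled-balanced : ∀ {F w} → Labelled F w → Balanced w
Labelled-balanced empty z = refl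
Labelled-balanced (branch {u = u} {v = v} a p q) z = begin
  δ z a + occurrences z (u ++ complement a ∷ v)
    ≡⟨ cong (δ z a +_) (occurrences-++ z u _) ⟩
  δ z a + (occurrences z u + (δ z (complement a) + occurrences z v))
    ≡⟨ step z a (Labelled-balanced p z) (Labelled-balanced q z) ⟩
  δ z̄ a + (occurrences z̄ u + (δ z̄ (complement a) + occurrences z̄ v))
    ≡⟨ cong (δ z̄ a +_) (occurrences-++ z̄ u _) ⟨
  δ z̄ a + occurrences z̄ (u ++ complement a ∷ v) ∎
  where
  open ≡-Reasoning
  z̄ = complement z
  step : ∀ z a {X Y X′ Y′} → X ≡ X′ → Y ≡ Y′ →
    δ z a + (X + (δ z (complement a) + Y)) ≡
    δ (complement z) a + (X′ + (δ (complement z) (complement a) + Y′))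
  step B  B  {X} {Y} refl refl = sym (+-suc X Y)
  step B  B̄ {X} {Y} refl refl = +-suc X Y
  step B̄ B  {X} {Y} refl refl = +-suc X Y
  step B̄ B̄ {X} {Y} refl refl = sym (+-suc X Y)

balanced-runs : ∀ a k j → Balanced (replicate k a ++ replicate j (complement a)) → k ≡ j
balanced-runs a k j balanced = begin
  k                                  ≡⟨ +-identityʳ k ⟨
  k + 0
    ≡⟨ cong₂ _+_ (occurrences-replicate-≡ a k) (occurrences-replicate-≢ (complement-irreflexive a) j) ⟨
  occurrences a (replicate k a) + occurrences a (replicate j ā)  ≡⟨ occurrences-++ a (replicate k a) _ ⟨
  occurrences a (replicate k a ++ replicate j ā)                 ≡⟨ balanced a ⟩
  occurrences ā (replicate k a ++ replicate j ā)                 ≡⟨ occurrences-++ ā (replicate k a) _ ⟩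
  occurrences ā (replicate k a) + occurrences ā (replicate j ā)
    ≡⟨ cong₂ _+_ (occurrences-replicate-≢ (complement-irreflexive a ∘ sym) k)
                 (occurrences-replicate-≡ ā j) ⟩
  j                                                              ∎
  where
  open ≡-Reasoning
  ā = complement a

run-++-∷ : ∀ {A : Set} {x y : A} → x ≢ y → ∀ k S u v → replicate k x ++ S ≡ u ++ y ∷ v →
  Σ (List A) λ u′ → u ≡ replicate k x ++ u′ × S ≡ u′ ++ y ∷ v
run-++-∷ x≢y zero    S u       v e = u , refl , e
run-++-∷ x≢y (suc k) S []      v e = ⊥-elim (x≢y (∷-injectiveˡ e))
run-++-∷ x≢y (suc k) S (_ ∷ u) v e with ∷-injectiveˡ e | run-++-∷ x≢y k S u v (∷-injectiveʳ e)
... | refl | u′ , refl , e′ = u′ , refl , e′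

replicate-≢-∷ : ∀ {A : Set} {y z : A} → y ≢ z → ∀ c u v → replicate c z ≢ u ++ y ∷ v
replicate-≢-∷ y≢z zero    []      v ()
replicate-≢-∷ y≢z zero    (_ ∷ u) v ()
replicate-≢-∷ y≢z (suc c) []      v e = y≢z (sym (∷-injectiveˡ e))
replicate-≢-∷ y≢z (suc c) (_ ∷ u) v e = replicate-≢-∷ y≢z c u v (∷-injectiveʳ e)

∷-in-run : ∀ {A : Set} {y z : A} → y ≢ z → ∀ m c u v →
  replicate m y ++ replicate c z ≡ u ++ y ∷ v →
  Σ ℕ λ j → Σ ℕ λ i → m ≡ j + suc i × u ≡ replicate j y × v ≡ replicate i y ++ replicate c z
∷-in-run y≢z zero    c u       v e = ⊥-elim (replicate-≢-∷ y≢z c u v e)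
∷-in-run y≢z (suc m) c []      v e = 0 , m , refl , refl , sym (∷-injectiveʳ e)
∷-in-run y≢z (suc m) c (_ ∷ u) v e with ∷-injectiveˡ e | ∷-in-run y≢z m c u v (∷-injectiveʳ e)
... | refl | j , i , refl , refl , e′ = suc j , i , refl , refl , e′

mutual
  canonical-forest : ∀ {F w} → Labelled F w → ∀ x k c →
    w ≡ canonical x (complement x) k c → F ≡ path k ++ path c
  canonical-forest empty          x zero    zero    _  = refl
  canonical-forest (branch a p q) x (suc k) c       eq = canonical-branch-forest a p q x k c eq
  canonical-forest (branch a p q) x zero    (suc c) eq =
    canonical-branch-forest a p q (complement x) c 0 (trans eq valley)
    where
    valley : replicate (suc c) (complement x) ++ replicate (suc c) x ≡
             canonical (complement x) (complement (complement x)) (suc c) 0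
    valley = cong (replicate (suc c) (complement x) ++_)
      (trans (cong (replicate (suc c)) (sym (complement-involutive x))) (sym (++-identityʳ _)))

  -- The partner of the leading a lies in the first run of complements, and the word between them is
  -- balanced; so the first tree carries a^k ā^k and the remaining trees ā^c a^c.
  canonical-branch-forest : ∀ {cs ts u v} a → Labelled cs u → Labelled ts v → ∀ x k c →
    a ∷ u ++ complement a ∷ v ≡ canonical x (complement x) (suc k) c →
    node cs ∷ ts ≡ path (suc k) ++ path c
  canonical-branch-forest a p q x k c eq with ∷-injectiveˡ eq
  ... | refl with run-++-∷ (complement-irreflexive a) k _ _ _ (sym (∷-injectiveʳ eq))
  ... | u′ , refl , rest
    with ∷-in-run (complement-irreflexive a ∘ sym) (suc k + c) c u′ _ (trans descent rest)
    where
    descent : replicate (suc k + c) (complement a) ++ replicate c a ≡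
              replicate (suc k) (complement a) ++ replicate c (complement a) ++ replicate c a
    descent = sym (replicate-++-replicate (suc k) c (complement a) (replicate c a))
  ... | j , i , k+c≡j+i , refl , refl with balanced-runs a k j (Labelled-balanced p)
  ... | refl with +-cancelˡ-≡ k c i (suc-injective (trans k+c≡j+i (+-suc k i)))
  ... | refl = cong₂ (λ cs ts → node cs ∷ ts)
    (trans (canonical-forest p a k 0 (sym (cong (replicate k a ++_) (++-identityʳ _)))) (++-identityʳ _))
    (canonical-forest q a 0 c refl)

Canonical : List Letter → Set
Canonical w =
  w ≡ [] ⊎ Σ Letter λ x → Σ ℕ λ k → Σ ℕ λ c → w ≡ canonical x (complement x) (suc k) c

¬onlyForest-childStartsWithComplement : ∀ {cs ts r v} a → Labelled cs (complement a ∷ r) → Labelled ts v →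
  ¬ OnlyForest (node cs ∷ ts) (a ∷ (complement a ∷ r) ++ complement a ∷ v)
¬onlyForest-childStartsWithComplement {v = v} a (branch {u = u₁} {v = u₂} _ p₁ p₂) q only
  with only _ (subst (Labelled _) regroup (branch a empty (Labelled-++ p₁ (branch a p₂ q))))
  where
  ā = complement a
  regroup : a ∷ ā ∷ u₁ ++ a ∷ u₂ ++ ā ∷ v ≡ a ∷ (ā ∷ u₁ ++ complement ā ∷ u₂) ++ ā ∷ v
  regroup = cong (λ z → a ∷ ā ∷ z)
    (trans (cong (λ b → u₁ ++ b ∷ u₂ ++ ā ∷ v) (sym (complement-involutive a))) (sym (++-assoc u₁ _ _)))
... | ()

¬onlyForest-siblingStartsWithRoot : ∀ {cs ts u r} a → Labelled cs u → Labelled ts (a ∷ r) →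
  ¬ OnlyForest (node cs ∷ ts) (a ∷ u ++ complement a ∷ a ∷ r)
¬onlyForest-siblingStartsWithRoot {cs} {u = u} a p (branch {u = u′} {v = v′} _ q₁ q₂) only
  with ++-identityʳ-unique cs (sym (node-injective (∷-injectiveˡ (only _ alternative))))
  where
  ā = complement a
  regroup : a ∷ (u ++ ā ∷ complement ā ∷ u′) ++ ā ∷ v′ ≡ a ∷ u ++ ā ∷ a ∷ u′ ++ ā ∷ v′
  regroup = cong (a ∷_)
    (trans (++-assoc u _ _) (cong (λ b → u ++ ā ∷ b ∷ u′ ++ ā ∷ v′) (complement-involutive a)))
  alternative = subst (Labelled _) regroup (branch a (Labelled-++ p (branch ā empty q₁)) q₂)
... | ()

++-assoc₄ : ∀ {A : Set} (a b c d e : List A) → (a ++ b ++ c ++ d) ++ e ≡ a ++ b ++ c ++ d ++ e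
++-assoc₄ a b c d e =
  trans (++-assoc a _ e) (cong (a ++_) (trans (++-assoc b _ e) (cong (b ++_) (++-assoc c d e))))

replicate-∷ʳ : ∀ {A : Set} n (z : A) → replicate n z ++ z ∷ [] ≡ replicate (suc n) z
replicate-∷ʳ n z = trans (replicate-++-∷ n z []) (cong (z ∷_) (++-identityʳ _))

nestedTree : ∀ x y → complement x ≡ y → complement y ≡ x → ∀ p s q r → suc p + r ≡ q + suc s →
  Σ PlaneTree λ T →
    Labelled (T ∷ []) (replicate (suc p) x ++ replicate q y ++ replicate r x ++ replicate (suc s) y)
nestedTree x y x̄≡y ȳ≡x zero s q r e with suc-injective (trans e (+-suc q s))
... | refl = node (path q ++ path s) ,
  subst (Labelled _) (cong (x ∷_) regroup)
    (branch′ x y x̄≡y (canonical-labelled y x ȳ≡x x̄≡y q s) empty)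
  where
  regroup : canonical y x q s ++ y ∷ [] ≡ replicate q y ++ replicate (q + s) x ++ replicate (suc s) y
  regroup = begin
    canonical y x q s ++ y ∷ []
      ≡⟨ ++-assoc₄ (replicate q y) (replicate q x) (replicate s x) (replicate s y) (y ∷ []) ⟩
    replicate q y ++ replicate q x ++ replicate s x ++ replicate s y ++ y ∷ []
      ≡⟨ cong (replicate q y ++_) (replicate-++-replicate q s x _) ⟩
    replicate q y ++ replicate (q + s) x ++ replicate s y ++ y ∷ []
      ≡⟨ cong (λ w → replicate q y ++ replicate (q + s) x ++ w) (replicate-∷ʳ s y) ⟩
    replicate q y ++ replicate (q + s) x ++ replicate (suc s) y
      ∎
    where open ≡-Reasoning
nestedTree x y x̄≡y ȳ≡x (suc p) zero q r e with suc-injective (trans e (+-comm q 1))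
... | refl = node (path (suc p) ++ path r) ,
  subst (Labelled _) (cong (x ∷_) regroup)
    (branch′ x y x̄≡y (canonical-labelled x y x̄≡y ȳ≡x (suc p) r) empty)
  where
  regroup : canonical x y (suc p) r ++ y ∷ [] ≡
            replicate (suc p) x ++ replicate (suc p + r) y ++ replicate r x ++ y ∷ []
  regroup = trans (++-assoc₄ (replicate (suc p) x) (replicate (suc p) y) (replicate r y) (replicate r x) (y ∷ []))
    (cong (replicate (suc p) x ++_) (replicate-++-replicate (suc p) r y _))
nestedTree x y x̄≡y ȳ≡x (suc p) (suc s) q r e
  with nestedTree x y x̄≡y ȳ≡x p s q r (suc-injective (trans e (+-suc q (suc s))))
... | T , t = node (T ∷ []) ,
  subst (Labelled _) (cong (x ∷_) regroup) (branch′ x y x̄≡y t empty)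
  where
  regroup : (replicate (suc p) x ++ replicate q y ++ replicate r x ++ replicate (suc s) y) ++ y ∷ [] ≡
            replicate (suc p) x ++ replicate q y ++ replicate r x ++ replicate (suc (suc s)) y
  regroup = trans (++-assoc₄ (replicate (suc p) x) (replicate q y) (replicate r x) (replicate (suc s) y) (y ∷ []))
    (cong (λ w → replicate (suc p) x ++ replicate q y ++ replicate r x ++ w) (replicate-∷ʳ (suc s) y))

¬onlyForest-childWithValley : ∀ {F ts v} a k c → Labelled ts v →
  ¬ OnlyForest F (a ∷ canonical a (complement a) (suc k) (suc c) ++ complement a ∷ v)
¬onlyForest-childWithValley {v = v} a k c q only
  with onlyForest-≡ only nested (subst (Labelled _) (sym regroup) separated)
  where
  ā = complement a
  nested = branch a (canonical-labelled a ā refl (complement-involutive a) (suc k) (suc c)) q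
  separated = Labelled-++ (path-labelled a ā refl (suc (suc k)))
    (Labelled-++ (path-labelled ā a (complement-involutive a) c) (Labelled-++ (path-labelled a ā refl 1) q))
  regroup : a ∷ canonical a ā (suc k) (suc c) ++ ā ∷ v ≡
    (replicate (suc (suc k)) a ++ replicate (suc (suc k)) ā) ++ (replicate c ā ++ replicate c a) ++ a ∷ ā ∷ v
  regroup = begin
    a ∷ canonical a ā (suc k) (suc c) ++ ā ∷ v
      ≡⟨ cong (a ∷_) (++-assoc₄ (replicate (suc k) a) (replicate (suc k) ā)
                                (replicate (suc c) ā) (replicate (suc c) a) (ā ∷ v)) ⟩
    replicate (suc (suc k)) a ++ replicate (suc k) ā ++ replicate (suc c) ā ++ replicate (suc c) a ++ ā ∷ v
      ≡⟨ cong (replicate (suc (suc k)) a ++_) (replicate-++-replicate (suc k) (suc c) ā _) ⟩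
    replicate (suc (suc k)) a ++ replicate (suc k + suc c) ā ++ replicate (suc c) a ++ ā ∷ v
      ≡⟨ cong (λ n → replicate (suc (suc k)) a ++ replicate n ā ++ a ∷ replicate c a ++ ā ∷ v)
              (+-suc (suc k) c) ⟩
    replicate (suc (suc k)) a ++ replicate (suc (suc k) + c) ā ++ a ∷ replicate c a ++ ā ∷ v
      ≡⟨ cong (replicate (suc (suc k)) a ++_) (replicate-++-replicate (suc (suc k)) c ā _) ⟨
    replicate (suc (suc k)) a ++ replicate (suc (suc k)) ā ++ replicate c ā ++ a ∷ replicate c a ++ ā ∷ v
      ≡⟨ cong (λ w → replicate (suc (suc k)) a ++ replicate (suc (suc k)) ā ++ replicate c ā ++ w)
              (replicate-++-∷ c a (ā ∷ v)) ⟨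
    replicate (suc (suc k)) a ++ replicate (suc (suc k)) ā ++ replicate c ā ++ replicate c a ++ a ∷ ā ∷ v
      ≡⟨ cong (λ w → replicate (suc (suc k)) a ++ replicate (suc (suc k)) ā ++ w)
              (++-assoc (replicate c ā) _ _) ⟨
    replicate (suc (suc k)) a ++ replicate (suc (suc k)) ā ++ (replicate c ā ++ replicate c a) ++ a ∷ ā ∷ v
      ≡⟨ ++-assoc (replicate (suc (suc k)) a) _ _ ⟨
    (replicate (suc (suc k)) a ++ replicate (suc (suc k)) ā) ++ (replicate c ā ++ replicate c a) ++ a ∷ ā ∷ v
      ∎
    where open ≡-Reasoning
... | ()

¬onlyForest-siblingWithPeak : ∀ {F} a k d e →
  ¬ OnlyForest F (a ∷ (replicate k a ++ replicate k (complement a)) ++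
                    complement a ∷ canonical (complement a) a (suc d) (suc e))
¬onlyForest-siblingWithPeak a k d e only
  with nestedTree a ā refl (complement-involutive a) k e (suc k + suc d) (suc d + suc e)
                  (sym (+-assoc (suc k) (suc d) (suc e)))
  where ā = complement a
... | T , t with onlyForest-≡ only (subst (Labelled _) (sym peak) separated) (subst (Labelled _) (sym merged) t)
  where
  ā = complement a
  Z = canonical ā a (suc d) (suc e)
  peak : a ∷ (replicate k a ++ replicate k ā) ++ ā ∷ Z ≡ replicate (suc k) a ++ replicate (suc k) ā ++ Z
  peak = cong (a ∷_) (trans (++-assoc (replicate k a) _ _) (cong (replicate k a ++_) (replicate-++-∷ k ā Z)))
  separated = subst (Labelled _) (++-assoc (replicate (suc k) a) _ _)
    (Labelled-++ (path-labelled a ā refl (suc k))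
                 (canonical-labelled ā a (complement-involutive a) refl (suc d) (suc e)))
  merged : a ∷ (replicate k a ++ replicate k ā) ++ ā ∷ Z ≡
    replicate (suc k) a ++ replicate (suc k + suc d) ā ++ replicate (suc d + suc e) a ++ replicate (suc e) ā
  merged = trans peak (cong (replicate (suc k) a ++_) (trans (replicate-++-replicate (suc k) (suc d) ā _)
    (cong (replicate (suc k + suc d) ā ++_) (replicate-++-replicate (suc d) (suc e) a _))))
... | ()

data ChildShape (a : Letter) : List Letter → Set where
  peak              : ∀ k → ChildShape a (replicate k a ++ replicate k (complement a))
  peak-valley       : ∀ k c → ChildShape a (canonical a (complement a) (suc k) (suc c))
  startsComplement : ∀ r → ChildShape a (complement a ∷ r)

childShape : ∀ a {u} → Canonical u → ChildShape a u
childShape a (inj₁ refl) = peak 0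
childShape a (inj₂ (x , k , c , refl)) with ≡-or-≡-complement a x | c
... | inj₂ refl | _      = startsComplement _
... | inj₁ refl | zero   =
  subst (ChildShape a) (cong (replicate (suc k) a ++_) (sym (++-identityʳ _))) (peak (suc k))
... | inj₁ refl | suc c′ = peak-valley k c′

data SiblingShape (a : Letter) : List Letter → Set where
  valley      : ∀ k → SiblingShape a (replicate k (complement a) ++ replicate k a)
  valley-peak : ∀ d e → SiblingShape a (canonical (complement a) a (suc d) (suc e))
  startsRoot  : ∀ r → SiblingShape a (a ∷ r)

siblingShape : ∀ a {v} → Canonical v → SiblingShape a v
siblingShape a (inj₁ refl) = valley 0
siblingShape a (inj₂ (x , k , c , refl)) with ≡-or-≡-complement a x | c
... | inj₁ refl | _      = startsRoot _
... | inj₂ refl | zero   = subst (SiblingShape a)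
  (cong (replicate (suc k) (complement a) ++_)
    (trans (sym (++-identityʳ _)) (cong (λ z → replicate (suc k) z ++ []) (sym (complement-involutive a)))))
  (valley (suc k))
... | inj₂ refl | suc c′ = subst (SiblingShape a)
  (cong (λ z → canonical (complement a) z (suc k) (suc c′)) (sym (complement-involutive a)))
  (valley-peak k c′)

branch-canonical : ∀ {cs ts u v} a → Labelled cs u → Labelled ts v →
  OnlyForest (node cs ∷ ts) (a ∷ u ++ complement a ∷ v) → ChildShape a u → SiblingShape a v →
  Canonical (a ∷ u ++ complement a ∷ v)
branch-canonical a p q only (startsComplement r) _ = ⊥-elim (¬onlyForest-childStartsWithComplement a p q only)
branch-canonical a p q only (peak-valley k c)     _ = ⊥-elim (¬onlyForest-childWithValley a k c q only)
branch-canonical a p q only (peak k) (startsRoot r)    = ⊥-elim (¬onlyForest-siblingStartsWithRoot a p q only)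
branch-canonical a p q only (peak k) (valley-peak d e) = ⊥-elim (¬onlyForest-siblingWithPeak a k d e only)
branch-canonical a p q only (peak k) (valley c)        = inj₂ (a , k , c , cong (a ∷_) regroup)
  where
  regroup : (replicate k a ++ replicate k (complement a)) ++
              complement a ∷ replicate c (complement a) ++ replicate c a ≡
            replicate k a ++ replicate (suc k) (complement a) ++ replicate c (complement a) ++ replicate c a
  regroup = trans (++-assoc (replicate k a) _ _) (cong (replicate k a ++_) (replicate-++-∷ k (complement a) _))

onlyForest⇒canonical : ∀ {F w} → Labelled F w → OnlyForest F w → Canonical w
onlyForest⇒canonical empty _ = inj₁ refl
onlyForest⇒canonical (branch {cs} {ts} a p q) only =
  branch-canonical a p q only (childShape a (onlyForest⇒canonical p onlyChildren))
                              (siblingShape a (onlyForest⇒canonical q onlySiblings))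
  where
  onlyChildren : OnlyForest cs _
  onlyChildren cs′ p′ = node-injective (∷-injectiveˡ (only _ (branch a p′ q)))
  onlySiblings : OnlyForest ts _
  onlySiblings ts′ q′ = ∷-injectiveʳ (only _ (branch a p q′))

length-canonical : ∀ x y a c → length (canonical x y a c) ≡ 2 * (a + c)
length-canonical x y a c = begin
  length (replicate a x ++ replicate a y ++ replicate c y ++ replicate c x)
    ≡⟨ length-++ (replicate a x) ⟩
  length (replicate a x) + length (replicate a y ++ replicate c y ++ replicate c x)
    ≡⟨ cong (length (replicate a x) +_)
         (trans (length-++ (replicate a y)) (cong (length (replicate a y) +_) (length-++ (replicate c y)))) ⟩
  length (replicate a x) + (length (replicate a y) + (length (replicate c y) + length (replicate c x)))
    ≡⟨ cong₂ _+_ (length-replicate a)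
         (cong₂ _+_ (length-replicate a) (cong₂ _+_ (length-replicate c) (length-replicate c))) ⟩
  a + (a + (c + c))
    ≡⟨ arith a c ⟩
  2 * (a + c) ∎
  where
  open ≡-Reasoning
  arith : ∀ a c → a + (a + (c + c)) ≡ 2 * (a + c)
  arith = solve-∀

canonical⇒exactlyOneValid : ∀ n (P : Vec Letter (2 * n)) x k c →
  toList P ≡ canonical x (complement x) k c → ExactlyOneValid n P
canonical⇒exactlyOneValid n P x k c eq = onlyForest⇒exactlyOneValid n P
  (subst (Labelled _) (sym eq) (canonical-labelled x _ refl (complement-involutive x) k c))
  (λ F p → canonical-forest p x k c eq)

replicate-++-∷-injective : ∀ {A : Set} {x y : A} → x ≢ y → ∀ a a′ r r′ →
  replicate a x ++ y ∷ r ≡ replicate a′ x ++ y ∷ r′ → a ≡ a′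
replicate-++-∷-injective x≢y zero     zero     r r′ e = refl
replicate-++-∷-injective x≢y zero     (suc a′) r r′ e = ⊥-elim (x≢y (sym (∷-injectiveˡ e)))
replicate-++-∷-injective x≢y (suc a)  zero     r r′ e = ⊥-elim (x≢y (∷-injectiveˡ e))
replicate-++-∷-injective x≢y (suc a)  (suc a′) r r′ e =
  cong suc (replicate-++-∷-injective x≢y a a′ r r′ (∷-injectiveʳ e))

toList-cast : ∀ {A : Set} {m n} .(eq : m ≡ n) (xs : Vec A m) → toList (cast eq xs) ≡ toList xs
toList-cast {n = zero}  eq Vec.[]       = refl
toList-cast {n = suc n} eq (x Vec.∷ xs) = cong (x ∷_) (toList-cast (cong pred eq) xs)

module Enumeration (m : ℕ) where

  word : Letter → Fin (suc m) → List Letter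
  word x j = canonical x (complement x) (suc (toℕ j)) (m ∸ toℕ j)

  length-word : ∀ x j → length (word x j) ≡ 2 * suc m
  length-word x j = trans (length-canonical x (complement x) (suc (toℕ j)) (m ∸ toℕ j))
    (cong (λ l → 2 * suc l) (m+[n∸m]≡n (≤-pred (toℕ<n j))))

  vec : Letter → Fin (suc m) → Vec Letter (2 * suc m)
  vec x j = cast (length-word x j) (fromList (word x j))

  toList-vec : ∀ x j → toList (vec x j) ≡ word x j
  toList-vec x j = trans (toList-cast (length-word x j) (fromList (word x j))) (toList∘fromList (word x j))

  vec-≡⇒word-≡ : ∀ x y i j → vec x i ≡ vec y j → word x i ≡ word y j
  vec-≡⇒word-≡ x y i j e = trans (sym (toList-vec x i)) (trans (cong toList e) (toList-vec y j))

  vec-injective : ∀ x {i j} → vec x i ≡ vec x j → i ≡ j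
  vec-injective x {i} {j} e = toℕ-injective
    (replicate-++-∷-injective (complement-irreflexive x) (toℕ i) (toℕ j) _ _
      (∷-injectiveʳ (vec-≡⇒word-≡ x x i j e)))

  words : List (Vec Letter (2 * suc m))
  words = map (vec B) (allFin (suc m)) ++ map (vec B̄) (allFin (suc m))

  words-unique : Unique words
  words-unique =
    ++⁺ (map⁺ (vec-injective B) (allFin⁺ (suc m))) (map⁺ (vec-injective B̄) (allFin⁺ (suc m))) disjoint
    where
    disjoint : ∀ {P} → P ∈ map (vec B) (allFin (suc m)) × P ∈ map (vec B̄) (allFin (suc m)) → ⊥
    disjoint (P∈B , P∈B̄)
      with ∈-map⁻ (vec B) {xs = allFin (suc m)} P∈B | ∈-map⁻ (vec B̄) {xs = allFin (suc m)} P∈B̄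
    ... | i , _ , refl | j , _ , e with ∷-injectiveˡ (vec-≡⇒word-≡ B B̄ i j e)
    ... | ()

  length-words : length words ≡ 2 * suc m
  length-words = begin
    length words                                     ≡⟨ length-++ (map (vec B) (allFin (suc m))) ⟩
    length (map (vec B) (allFin (suc m))) + length (map (vec B̄) (allFin (suc m)))
      ≡⟨ cong₂ _+_ (length-map (vec B) (allFin (suc m))) (length-map (vec B̄) (allFin (suc m))) ⟩
    length (allFin (suc m)) + length (allFin (suc m))
      ≡⟨ cong₂ _+_ (length-tabulate {A = Fin (suc m)} id) (length-tabulate {A = Fin (suc m)} id) ⟩
    suc m + suc m                                    ≡⟨ cong (suc m +_) (+-identityʳ (suc m)) ⟨
    2 * suc m                                        ∎
    where open ≡-Reasoning

  vec∈words : ∀ x j → vec x j ∈ words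
  vec∈words B  j = ∈-++⁺ˡ (∈-map⁺ (vec B) (∈-allFin j))
  vec∈words B̄ j = ∈-++⁺ʳ (map (vec B) (allFin (suc m))) (∈-map⁺ (vec B̄) (∈-allFin j))

  ∈map⇒exactlyOneValid : ∀ x {P} → P ∈ map (vec x) (allFin (suc m)) → ExactlyOneValid (suc m) P
  ∈map⇒exactlyOneValid x P∈ with ∈-map⁻ (vec x) {xs = allFin (suc m)} P∈
  ... | j , _ , refl =
    canonical⇒exactlyOneValid (suc m) (vec x j) x (suc (toℕ j)) (m ∸ toℕ j) (toList-vec x j)

  ∈words⇒exactlyOneValid : ∀ P → P ∈ words → ExactlyOneValid (suc m) P
  ∈words⇒exactlyOneValid P P∈ =
    [ ∈map⇒exactlyOneValid B , ∈map⇒exactlyOneValid B̄ ]′ (∈-++⁻ (map (vec B) (allFin (suc m))) P∈)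

  canonical⇒∈words : ∀ P x k c → toList P ≡ canonical x (complement x) (suc k) c → P ∈ words
  canonical⇒∈words P x k c eq = subst (_∈ words) (sym P≡vec) (vec∈words x j)
    where
    k+c≡m : k + c ≡ m
    k+c≡m = suc-injective (*-cancelˡ-≡ (suc k + c) (suc m) 2
      (trans (sym (length-canonical x (complement x) (suc k) c)) (trans (cong length (sym eq)) (length-toList P))))
    k<1+m : k < suc m
    k<1+m = s≤s (subst (k ≤_) k+c≡m (m≤m+n k c))
    j = fromℕ< k<1+m
    c≡m∸j : c ≡ m ∸ toℕ j
    c≡m∸j = trans (sym (m+n∸m≡n k c)) (cong₂ _∸_ k+c≡m (sym (toℕ-fromℕ< k<1+m)))
    P≡vec : P ≡ vec x j
    P≡vec = trans (sym (cast-is-id refl P)) (toList-injective refl P (vec x j) (trans eq (trans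
      (cong₂ (λ a b → canonical x (complement x) (suc a) b) (sym (toℕ-fromℕ< k<1+m)) c≡m∸j)
      (sym (toList-vec x j)))))

  exactlyOneValid⇒∈words : ∀ P → ExactlyOneValid (suc m) P → P ∈ words
  exactlyOneValid⇒∈words P h with exactlyOneValid⇒onlyForest (suc m) P h
  ... | F , p , only with onlyForest⇒canonical p only
  ... | inj₂ (x , k , c , eq) = canonical⇒∈words P x k c eq
  ... | inj₁ eq with trans (sym (length-toList P)) (cong length eq)
  ...   | ()

mainTheorem11 : (n : ℕ) → n ≥ 1 →
    Σ (List (Vec Letter (2 * n))) λ L →
      Unique L × length L ≡ 2 * n × (∀ P → (P ∈ L ⇔ ExactlyOneValid n P))
mainTheorem11 (suc m) _ =
  words , words-unique , length-words , λ P → mk⇔ (∈words⇒exactlyOneValid P) (exactlyOneValid⇒∈words P)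
  where open Enumeration m
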